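{- Any amply regular graph $G$ with parameters $(d,\alpha,\beta)$ such that $1\neq\beta\geq\alpha$ has edge-connectivity $k'(G)=d$.
   Context: A $d$-regular graph $G$ is amply regular with parameters $(d,\alpha,\beta)$ if any two adjacent vertices have exactly $\alpha$ common neighbors and any two vertices at distance two have exactly $\beta$ common neighbors. The edge-connectivity $k'(G)$ is the minimum number of edges whose removal disconnects $G$. -}

module Defs where

open import Data.Nat using (ℕ; zero; suc; _≤_; _<_; _+_)
open import Data.Bool using (Bool; true; false; _∧_; _∨_; not; if_then_else_)
open import Data.Fin using (Fin; toℕ)
open import Data.Fin.Properties using () renaming (_<?_ to _<ᶠ?_)
open import Data.List using (List; []; _∷_; concatMap; map)
open import Data.List.Base using (allFin)
open import Data.Product using (Σ; _×_; _,_; ∃; ∃-syntax)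
open import Relation.Nullary using (¬_; does)
open import Relation.Binary.PropositionalEquality using (_≡_; _≢_)
open import Relation.Binary.Construct.Closure.ReflexiveTransitive using (Star)

countB : {A : Set} → (A → Bool) → List A → ℕ
countB p [] = 0
countB p (x ∷ xs) = if p x then suc (countB p xs) else countB p xs

record Graph : Set where
  field
    n     : ℕ
    adj   : Fin n → Fin n → Bool
    sym   : ∀ u v → adj u v ≡ adj v u
    irrefl : ∀ v → adj v v ≡ false

module _ (G : Graph) where
  open Graph G

  Adj : Fin n → Fin n → Set
  Adj u v = adj u v ≡ true

  degree : Fin n → ℕ
  degree v = countB (adj v) (allFin n)

  Regular : ℕ → Set
  Regular d = ∀ v → degree v ≡ d

  commonNeighbours : Fin n → Fin n → ℕ
  commonNeighbours x y = countB (λ z → adj x z ∧ adj y z) (allFin n)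

  Dist2 : Fin n → Fin n → Set
  Dist2 x y = x ≢ y × adj x y ≡ false × ∃[ z ] (Adj x z × Adj z y)

  AmplyRegular : ℕ → ℕ → ℕ → Set
  AmplyRegular d α β =
    Regular d
    × (∀ x y → Adj x y → commonNeighbours x y ≡ α)
    × (∀ x y → Dist2 x y → commonNeighbours x y ≡ β)

  Connected : Set
  Connected = ∀ u v → Star Adj u v

  -- An edge set F ⊆ E(G) is encoded by a Boolean matrix: the edge {u,v} of G
  -- belongs to F iff  F u v ∨ F v u  is true.
  inF : (Fin n → Fin n → Bool) → Fin n → Fin n → Bool
  inF F u v = adj u v ∧ (F u v ∨ F v u)

  edgeCount : (Fin n → Fin n → Bool) → ℕ
  edgeCount F = countB (λ p → does (Data.Product.proj₁ p <ᶠ? Data.Product.proj₂ p)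
                                ∧ inF F (Data.Product.proj₁ p) (Data.Product.proj₂ p))
                       (concatMap (λ u → map (λ v → (u , v)) (allFin n)) (allFin n))

  AdjMinus : (Fin n → Fin n → Bool) → Fin n → Fin n → Set
  AdjMinus F u v = adj u v ∧ not (F u v ∨ F v u) ≡ true

  Disconnects : (Fin n → Fin n → Bool) → Set
  Disconnects F = ∃[ u ] ∃[ v ] ¬ Star (AdjMinus F) u v

  EdgeConnectivity : ℕ → Set
  EdgeConnectivity k =
    (∀ F → Disconnects F → k ≤ edgeCount F)
    × (∃[ F ] (Disconnects F × edgeCount F ≡ k))

-- Let S be a vertex set and xy an edge with x ∈ S and y ∉ S; we show that at least d edges leave S.
-- Write out v for the number of neighbours of v outside S, X = N(y) ∩ S and A = (N(x) ∩ S) ∖ N(y).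
-- Then d = out x + |N(x) ∩ N(y) ∩ S| + |A| with the middle term at most |X ∖ x|, while at least
-- out x + Σ_{X∖x} out + Σ_A out edges leave S and out ≥ 1 on X ∖ x. Each w ∈ A is at distance two
-- from y, so β ≤ |N(w) ∩ X| + out w.
--   If y has fewer than β neighbours in S, this gives out ≥ 1 on A and the bound follows termwise;
-- the same argument applies to the complement of S, along the edge yv, when some v ∈ X ∖ x has
-- out v < β. If β = 0 then A is empty. Otherwise β ≥ 2 and out ≥ β on X ∖ x; counting the edges
-- between A and X from the side of X, where each v ∈ X ∖ x has fewer than max(α, β) = β neighbours
-- in A (y is a common neighbour of v and x outside A), yields at least out x + |X ∖ x| + (β − 1)|A|
-- edges leaving S.
--   A disconnecting edge set contains every edge leaving the set of vertices reachable from one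
-- side, and the d edges at a single vertex disconnect it.

module Submission where

open import Defs
open import Data.Nat using (ℕ; zero; suc; _+_; _*_; _≤_; _<_; _≥_; z≤n; s≤s)
open import Data.Nat.Properties
open import Data.Bool using (Bool; true; false; _∧_; _∨_; not; if_then_else_)
open import Data.Bool.Properties using (not-involutive; ¬-not; not-¬; ∨-comm; ∧-zeroʳ) renaming (_≟_ to _≟ᵇ_)
open import Data.Fin using (Fin; zero; suc; toℕ; fromℕ<)
open import Data.Fin.Properties using (any?; toℕ-fromℕ<; toℕ-injective) renaming (_≟_ to _≟ᶠ_; _<?_ to _<ᶠ?_)
open import Data.List using (List; []; _∷_; _++_; map; concatMap; tabulate)
open import Data.List.Base using (allFin)
open import Data.Product using (_×_; _,_; proj₁; proj₂; ∃-syntax; uncurry)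
open import Data.Sum using (_⊎_; inj₁; inj₂)
open import Function using (_∘_; id)
open import Relation.Nullary using (¬_; Dec; does; yes; no; contradiction; _×-dec_)
open import Relation.Nullary.Decidable using (dec-true; dec-false)
open import Relation.Binary.PropositionalEquality
open import Relation.Binary.Construct.Closure.ReflexiveTransitive using (Star; ε; _◅_; _◅◅_)
open import Data.Nat.Solver using (module +-*-Solver)
open +-*-Solver using (solve; _:+_; _:*_; _:=_; con)
open import Algebra.Properties.Semiring.Sum +-*-semiring
  using (sum; sum-cong-≗; sum-replicate-zero; ∑-distrib-+; ∑-comm; *-distribʳ-sum)

∧-true⁻ : ∀ a {b} → a ∧ b ≡ true → a ≡ true × b ≡ true
∧-true⁻ true e = refl , e

∧-true⁺ : ∀ {a b} → a ≡ true → b ≡ true → a ∧ b ≡ true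
∧-true⁺ refl e = e

not-true⁻ : ∀ {a} → not a ≡ true → a ≡ false
not-true⁻ {false} _ = refl

_<ᵇ_ : ∀ {n} → Fin n → Fin n → Bool
u <ᵇ v = does (u <ᶠ? v)

<ᵇ-false∧≢⇒< : ∀ {n} {u v : Fin n} → v <ᵇ u ≡ false → u ≢ v → toℕ u < toℕ v
<ᵇ-false∧≢⇒< {u = u} {v} v≮u u≢v =
  ≤∧≢⇒< (≮⇒≥ λ v<u → contradiction v≮u (not-¬ (dec-true (v <ᶠ? u) v<u)))
        (u≢v ∘ toℕ-injective)

∑-mono-≤ : ∀ {n} {f g : Fin n → ℕ} → (∀ i → f i ≤ g i) → sum f ≤ sum g
∑-mono-≤ {zero} _ = z≤n
∑-mono-≤ {suc n} f≤g = +-mono-≤ (f≤g zero) (∑-mono-≤ (f≤g ∘ suc))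

∑-indicator : ∀ {n} (x : Fin n) (c : ℕ) → sum (λ i → if does (i ≟ᶠ x) then c else 0) ≡ c
∑-indicator {suc n} zero c = trans (cong (c +_) (sum-replicate-zero n)) (+-identityʳ c)
∑-indicator {suc n} (suc x) c = ∑-indicator x c

module _ {n : ℕ} where

  ∑⟨_⟩ : (Fin n → Bool) → (Fin n → ℕ) → ℕ
  ∑⟨ p ⟩ f = sum λ i → if p i then f i else 0

  count : (Fin n → Bool) → ℕ
  count p = ∑⟨ p ⟩ λ _ → 1

  _⊆_ : (Fin n → Bool) → (Fin n → Bool) → Set
  p ⊆ q = ∀ i → p i ≡ true → q i ≡ true

  _∖_ : (Fin n → Bool) → Fin n → Fin n → Bool
  (p ∖ x) i = not (does (i ≟ᶠ x)) ∧ p i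

  ∖-⊆ : ∀ {p x} → (p ∖ x) ⊆ p
  ∖-⊆ {x = x} i e = proj₂ (∧-true⁻ (not (does (i ≟ᶠ x))) e)

  ∖-≢ : ∀ {p x i} → (p ∖ x) i ≡ true → i ≢ x
  ∖-≢ {x = x} e refl with x ≟ᶠ x | e
  ... | yes _   | ()
  ... | no x≢x  | _ = x≢x refl

  ∖-intro : ∀ {p x i} → p i ≡ true → i ≢ x → (p ∖ x) i ≡ true
  ∖-intro {x = x} {i} pi i≢x rewrite dec-false (i ≟ᶠ x) i≢x = pi

  ∑⟨⟩-cong : ∀ {p q f g} → (∀ i → p i ≡ q i) → (∀ i → q i ≡ true → f i ≡ g i) →
             ∑⟨ p ⟩ f ≡ ∑⟨ q ⟩ g
  ∑⟨⟩-cong {p} {q} {f} {g} p≗q f≗g = sum-cong-≗ pointwise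
    where
    pointwise : ∀ i → (if p i then f i else 0) ≡ (if q i then g i else 0)
    pointwise i rewrite p≗q i with q i in qi
    ... | true  = f≗g i qi
    ... | false = refl

  count-cong : ∀ {p q} → (∀ i → p i ≡ q i) → count p ≡ count q
  count-cong p≗q = ∑⟨⟩-cong p≗q (λ _ _ → refl)

  ∑⟨⟩-mono : ∀ {p q f g} → p ⊆ q → (∀ i → p i ≡ true → f i ≤ g i) → ∑⟨ p ⟩ f ≤ ∑⟨ q ⟩ g
  ∑⟨⟩-mono {p} {q} {f} {g} p⊆q f≤g = ∑-mono-≤ pointwise
    where
    pointwise : ∀ i → (if p i then f i else 0) ≤ (if q i then g i else 0)
    pointwise i with p i in pi
    ... | false = z≤n
    ... | true rewrite p⊆q i pi = f≤g i pi

  ∑⟨⟩-distrib-+ : ∀ (p : Fin n → Bool) (f g : Fin n → ℕ) → ∑⟨ p ⟩ (λ i → f i + g i) ≡ ∑⟨ p ⟩ f + ∑⟨ p ⟩ g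
  ∑⟨⟩-distrib-+ p f g =
    trans (sum-cong-≗ pointwise) (∑-distrib-+ (λ i → if p i then f i else 0) (λ i → if p i then g i else 0))
    where
    pointwise : ∀ i → (if p i then f i + g i else 0) ≡ (if p i then f i else 0) + (if p i then g i else 0)
    pointwise i with p i
    ... | true  = refl
    ... | false = refl

  ∑⟨⟩-split : ∀ (p q : Fin n → Bool) (f : Fin n → ℕ) →
              ∑⟨ p ⟩ f ≡ ∑⟨ (λ i → q i ∧ p i) ⟩ f + ∑⟨ (λ i → not (q i) ∧ p i) ⟩ f
  ∑⟨⟩-split p q f =
    trans (sum-cong-≗ pointwise)
          (∑-distrib-+ (λ i → if q i ∧ p i then f i else 0) (λ i → if not (q i) ∧ p i then f i else 0))
    where
    pointwise : ∀ i → (if p i then f i else 0) ≡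
                      (if q i ∧ p i then f i else 0) + (if not (q i) ∧ p i then f i else 0)
    pointwise i with q i | p i
    ... | true  | true  = sym (+-identityʳ _)
    ... | true  | false = refl
    ... | false | _     = refl

  ∑⟨⟩-disjoint : ∀ {p₁ p₂ q} (f : Fin n → ℕ) → p₁ ⊆ q → p₂ ⊆ q →
                 (∀ i → p₁ i ≡ true → p₂ i ≡ false) → ∑⟨ p₁ ⟩ f + ∑⟨ p₂ ⟩ f ≤ ∑⟨ q ⟩ f
  ∑⟨⟩-disjoint {p₁} {p₂} {q} f p₁⊆q p₂⊆q disjoint =
    subst (_≤ ∑⟨ q ⟩ f) (∑-distrib-+ (λ i → if p₁ i then f i else 0) (λ i → if p₂ i then f i else 0))
          (∑-mono-≤ pointwise)
    where
    pointwise : ∀ i → (if p₁ i then f i else 0) + (if p₂ i then f i else 0) ≤ (if q i then f i else 0)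
    pointwise i with p₁ i in e₁ | p₂ i in e₂
    ... | true  | true  = contradiction (disjoint i e₁) (not-¬ e₂)
    ... | true  | false rewrite p₁⊆q i e₁ = ≤-reflexive (+-identityʳ _)
    ... | false | true  rewrite p₂⊆q i e₂ = ≤-refl
    ... | false | false = z≤n

  ∑⟨⟩-const : ∀ (p : Fin n → Bool) c → ∑⟨ p ⟩ (λ _ → c) ≡ count p * c
  ∑⟨⟩-const p c = trans (sum-cong-≗ pointwise) (sym (*-distribʳ-sum c (λ i → if p i then 1 else 0)))
    where
    pointwise : ∀ i → (if p i then c else 0) ≡ (if p i then 1 else 0) * c
    pointwise i with p i
    ... | true  = sym (*-identityˡ c)
    ... | false = refl

  ∑⟨⟩-≥-const : ∀ {p f c} → (∀ i → p i ≡ true → c ≤ f i) → count p * c ≤ ∑⟨ p ⟩ f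
  ∑⟨⟩-≥-const {p} {c = c} c≤f = subst (_≤ _) (∑⟨⟩-const p c) (∑⟨⟩-mono (λ _ e → e) c≤f)

  ∑⟨⟩-≤-const : ∀ {p f c} → (∀ i → p i ≡ true → f i ≤ c) → ∑⟨ p ⟩ f ≤ count p * c
  ∑⟨⟩-≤-const {p} {c = c} f≤c = subst (_ ≤_) (∑⟨⟩-const p c) (∑⟨⟩-mono (λ _ e → e) f≤c)

  count≤∑⟨⟩ : ∀ {p f} → (∀ i → p i ≡ true → 0 < f i) → count p ≤ ∑⟨ p ⟩ f
  count≤∑⟨⟩ = ∑⟨⟩-mono (λ _ e → e)

  ∑⟨⟩-zero : ∀ {p f} → (∀ i → p i ≡ true → f i ≡ 0) → ∑⟨ p ⟩ f ≡ 0
  ∑⟨⟩-zero {p} f≡0 = trans (∑⟨⟩-cong (λ _ → refl) f≡0) (trans (∑⟨⟩-const p 0) (*-zeroʳ (count p)))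

  count-empty : ∀ {p} → (∀ i → p i ≡ false) → count p ≡ 0
  count-empty p≗false = trans (count-cong p≗false) (sum-replicate-zero n)

  ∑⟨⟩-remove : ∀ {p} x (f : Fin n → ℕ) → p x ≡ true → ∑⟨ p ⟩ f ≡ f x + ∑⟨ p ∖ x ⟩ f
  ∑⟨⟩-remove {p} x f px = begin
    ∑⟨ p ⟩ f
      ≡⟨ ∑⟨⟩-split p (λ i → does (i ≟ᶠ x)) f ⟩
    ∑⟨ (λ i → does (i ≟ᶠ x) ∧ p i) ⟩ f + ∑⟨ p ∖ x ⟩ f
      ≡⟨ cong (_+ ∑⟨ p ∖ x ⟩ f) (sum-cong-≗ pointwise) ⟩
    sum (λ i → if does (i ≟ᶠ x) then f x else 0) + ∑⟨ p ∖ x ⟩ f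
      ≡⟨ cong (_+ ∑⟨ p ∖ x ⟩ f) (∑-indicator x (f x)) ⟩
    f x + ∑⟨ p ∖ x ⟩ f ∎
    where
    open ≡-Reasoning
    pointwise : ∀ i → (if does (i ≟ᶠ x) ∧ p i then f i else 0) ≡ (if does (i ≟ᶠ x) then f x else 0)
    pointwise i with i ≟ᶠ x
    ... | yes refl rewrite px = refl
    ... | no _ = refl

  count-mono : ∀ {p q} → p ⊆ q → count p ≤ count q
  count-mono p⊆q = ∑⟨⟩-mono p⊆q (λ _ _ → ≤-refl)

  count-remove : ∀ {p} x → p x ≡ true → count p ≡ suc (count (p ∖ x))
  count-remove x = ∑⟨⟩-remove x (λ _ → 1)

  count-pos : ∀ {p} x → p x ≡ true → 0 < count p
  count-pos x px = subst (0 <_) (sym (count-remove x px)) (s≤s z≤n)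

  count-strict : ∀ {p q} x → p ⊆ q → p x ≡ false → q x ≡ true → count p < count q
  count-strict {p} {q} x p⊆q px qx = subst (count p <_) (sym (count-remove x qx)) (s≤s (count-mono p⊆q∖x))
    where
    p⊆q∖x : p ⊆ (q ∖ x)
    p⊆q∖x i pi with i ≟ᶠ x
    ... | yes refl = contradiction px (not-¬ pi)
    ... | no _     = p⊆q i pi

count≤n : ∀ {n} (p : Fin n → Bool) → count p ≤ n
count≤n {zero}  p = z≤n
count≤n {suc n} p with p zero
... | true  = s≤s (count≤n (p ∘ suc))
... | false = m≤n⇒m≤1+n (count≤n (p ∘ suc))

∑⟨⟩-count : ∀ {m n} (p : Fin m → Bool) (r : Fin m → Fin n → Bool) →
            ∑⟨ p ⟩ (λ i → count (r i)) ≡ sum (λ i → count (λ j → p i ∧ r i j))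
∑⟨⟩-count {n = n} p r = sum-cong-≗ λ i → restrict (p i) (r i)
  where
  restrict : ∀ b (q : Fin n → Bool) → (if b then count q else 0) ≡ count (λ j → b ∧ q j)
  restrict true  q = refl
  restrict false q = sym (sum-replicate-zero n)

∑⟨⟩-count-comm : ∀ {m n} (p : Fin m → Bool) (q : Fin n → Bool) (R : Fin m → Fin n → Bool) →
                 ∑⟨ p ⟩ (λ i → count (λ j → q j ∧ R i j)) ≡ ∑⟨ q ⟩ (λ j → count (λ i → p i ∧ R i j))
∑⟨⟩-count-comm p q R = begin
  ∑⟨ p ⟩ (λ i → count (λ j → q j ∧ R i j))
    ≡⟨ ∑⟨⟩-count p (λ i j → q j ∧ R i j) ⟩
  sum (λ i → count (λ j → p i ∧ (q j ∧ R i j)))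
    ≡⟨ ∑-comm (λ i j → if p i ∧ (q j ∧ R i j) then 1 else 0) ⟩
  sum (λ j → sum (λ i → if p i ∧ (q j ∧ R i j) then 1 else 0))
    ≡⟨ sum-cong-≗ (λ j → count-cong (λ i → swap (p i) (q j))) ⟩
  sum (λ j → count (λ i → q j ∧ (p i ∧ R i j)))
    ≡⟨ ∑⟨⟩-count q (λ j i → p i ∧ R i j) ⟨
  ∑⟨ q ⟩ (λ j → count (λ i → p i ∧ R i j)) ∎
  where
  open ≡-Reasoning
  swap : ∀ a b {c} → a ∧ (b ∧ c) ≡ b ∧ (a ∧ c)
  swap true  b = refl
  swap false true  = refl
  swap false false = refl

∑-count-orient : ∀ {n} (c : Fin n → Fin n → Bool) →
                 sum (λ u → count (c u)) ≡
                 sum (λ u → count (λ v → u <ᵇ v ∧ c u v) + count (λ v → not (v <ᵇ u) ∧ c v u))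
∑-count-orient {n} c = begin
  sum (λ u → count (c u))
    ≡⟨ sum-cong-≗ (λ u → ∑⟨⟩-split (c u) (u <ᵇ_) (λ _ → 1)) ⟩
  sum (λ u → upward u + count (λ v → not (u <ᵇ v) ∧ c u v))
    ≡⟨ ∑-distrib-+ upward (λ u → count (λ v → not (u <ᵇ v) ∧ c u v)) ⟩
  sum upward + sum (λ u → count (λ v → not (u <ᵇ v) ∧ c u v))
    ≡⟨ cong (sum upward +_) (∑-comm (λ u v → if not (u <ᵇ v) ∧ c u v then 1 else 0)) ⟩
  sum upward + sum (λ u → count (λ v → not (v <ᵇ u) ∧ c v u))
    ≡⟨ ∑-distrib-+ upward (λ u → count (λ v → not (v <ᵇ u) ∧ c v u)) ⟨
  sum (λ u → upward u + count (λ v → not (v <ᵇ u) ∧ c v u)) ∎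
  where
  open ≡-Reasoning
  upward : Fin n → ℕ
  upward u = count (λ v → u <ᵇ v ∧ c u v)

countB-++ : ∀ {A : Set} (p : A → Bool) (xs ys : List A) → countB p (xs ++ ys) ≡ countB p xs + countB p ys
countB-++ p []       ys = refl
countB-++ p (x ∷ xs) ys with p x
... | true  = cong suc (countB-++ p xs ys)
... | false = countB-++ p xs ys

countB-map : ∀ {A B : Set} (p : B → Bool) (g : A → B) (xs : List A) → countB p (map g xs) ≡ countB (p ∘ g) xs
countB-map p g []       = refl
countB-map p g (x ∷ xs) with p (g x)
... | true  = cong suc (countB-map p g xs)
... | false = countB-map p g xs

countB-tabulate : ∀ {A : Set} {n} (p : A → Bool) (f : Fin n → A) → countB p (tabulate f) ≡ count (p ∘ f)
countB-tabulate {n = zero}  p f = refl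
countB-tabulate {n = suc n} p f with p (f zero)
... | true  = cong suc (countB-tabulate p (f ∘ suc))
... | false = countB-tabulate p (f ∘ suc)

countB-allFin : ∀ {n} (p : Fin n → Bool) → countB p (allFin n) ≡ count p
countB-allFin p = countB-tabulate p id

countB-concatMap-tabulate : ∀ {A B : Set} {n} (p : B → Bool) (h : A → List B) (f : Fin n → A) →
                            countB p (concatMap h (tabulate f)) ≡ sum (λ i → countB p (h (f i)))
countB-concatMap-tabulate {n = zero}  p h f = refl
countB-concatMap-tabulate {n = suc n} p h f =
  trans (countB-++ p (h (f zero)) _) (cong (countB p (h (f zero)) +_) (countB-concatMap-tabulate p h (f ∘ suc)))

≢1⇒≡0⊎≥2 : ∀ {m} → m ≢ 1 → m ≡ 0 ⊎ 2 ≤ m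
≢1⇒≡0⊎≥2 {zero}        _   = inj₁ refl
≢1⇒≡0⊎≥2 {suc zero}    m≢1 = contradiction refl m≢1
≢1⇒≡0⊎≥2 {suc (suc m)} _   = inj₂ (s≤s (s≤s z≤n))

-- Summing the hypotheses gives a + k + (β − 1) s ≤ cut.
dense-arith : ∀ {a k s E EA H β cut} → a + E + EA ≤ cut → k * β ≤ E → s * β ≤ H + EA →
              H + k ≤ s + k * β → 2 ≤ β → a + k + s ≤ cut
dense-arith {a} {k} {s} {E} {EA} {H} {β} {cut} cut≥ E≥ EA≥ H≤ 2≤β =
  +-cancelʳ-≤ (s + k * β) (a + k + s) cut (begin
    a + k + s + (s + k * β)
      ≡⟨ solve 4 (λ a k s kβ → a :+ k :+ s :+ (s :+ kβ) := a :+ kβ :+ (s :+ s) :+ k) refl a k s (k * β) ⟩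
    a + k * β + (s + s) + k     ≤⟨ +-monoˡ-≤ k (+-monoʳ-≤ (a + k * β) s+s≤sβ) ⟩
    a + k * β + s * β + k       ≤⟨ +-monoˡ-≤ k (+-mono-≤ (+-monoʳ-≤ a E≥) EA≥) ⟩
    a + E + (H + EA) + k        ≡⟨ solve 5 (λ a E H EA k → a :+ E :+ (H :+ EA) :+ k := a :+ E :+ EA :+ (H :+ k)) refl a E H EA k ⟩
    a + E + EA + (H + k)        ≤⟨ +-mono-≤ cut≥ H≤ ⟩
    cut + (s + k * β)           ∎)
  where
  open ≤-Reasoning
  s+s≤sβ : s + s ≤ s * β
  s+s≤sβ = subst (_≤ s * β) (solve 1 (λ s → s :* con 2 := s :+ s) refl s) (*-monoʳ-≤ s 2≤β)

module _ (G : Graph) where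
  open Graph G renaming (sym to adj-sym)

  adj-sym′ : ∀ {u v} → adj u v ≡ true → adj v u ≡ true
  adj-sym′ {u} {v} e = trans (adj-sym v u) e

  adj⇒≢ : ∀ {u v} → adj u v ≡ true → u ≢ v
  adj⇒≢ {u} e refl = contradiction (irrefl u) (not-¬ e)

  degIn : (Fin n → Bool) → Fin n → ℕ
  degIn S v = count (λ w → S w ∧ adj v w)

  cutSize : (Fin n → Bool) → ℕ
  cutSize S = ∑⟨ S ⟩ (degIn (not ∘ S))

  cutSize-complement : ∀ S → cutSize (not ∘ S) ≡ cutSize S
  cutSize-complement S = begin
    ∑⟨ not ∘ S ⟩ (λ v → count (λ w → not (not (S w)) ∧ adj v w))
      ≡⟨ ∑⟨⟩-cong (λ _ → refl) (λ v _ → count-cong (λ w → cong (_∧ adj v w) (not-involutive (S w)))) ⟩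
    ∑⟨ not ∘ S ⟩ (λ v → count (λ w → S w ∧ adj v w))
      ≡⟨ ∑⟨⟩-count-comm (not ∘ S) S adj ⟩
    ∑⟨ S ⟩ (λ w → count (λ v → not (S v) ∧ adj v w))
      ≡⟨ ∑⟨⟩-cong (λ _ → refl) (λ w _ → count-cong (λ v → cong (not (S v) ∧_) (adj-sym v w))) ⟩
    cutSize S ∎
    where open ≡-Reasoning

  edgeCount≡∑ : ∀ F → edgeCount G F ≡ sum (λ u → count (λ v → u <ᵇ v ∧ inF G F u v))
  edgeCount≡∑ F = trans (countB-concatMap-tabulate (uncurry edge) (λ u → map (u ,_) (allFin n)) id)
                        (sum-cong-≗ λ u → trans (countB-map (uncurry edge) (u ,_) (allFin n)) (countB-allFin (edge u)))
    where
    edge : Fin n → Fin n → Bool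
    edge u v = u <ᵇ v ∧ inF G F u v

  inF-sym : ∀ F u v → inF G F u v ≡ inF G F v u
  inF-sym F u v = cong₂ _∧_ (adj-sym u v) (∨-comm (F u v) (F v u))

  cutSize≤edgeCount : ∀ F S → (∀ a b → S a ≡ true → S b ≡ false → adj a b ≡ true → inF G F a b ≡ true) →
                      cutSize S ≤ edgeCount G F
  cutSize≤edgeCount F S leaving = begin
    cutSize S                                        ≡⟨ ∑⟨⟩-count S (λ u v → not (S v) ∧ adj u v) ⟩
    sum (λ u → count (c u))                          ≡⟨ ∑-count-orient c ⟩
    sum (λ u → count (λ v → u <ᵇ v ∧ c u v) + count (λ v → not (v <ᵇ u) ∧ c v u))
      ≤⟨ ∑-mono-≤ (λ u → ∑⟨⟩-disjoint (λ _ → 1) (upward u) (downward u) (disjoint u)) ⟩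
    sum (λ u → count (λ v → u <ᵇ v ∧ inF G F u v))   ≡⟨ edgeCount≡∑ F ⟨
    edgeCount G F                                    ∎
    where
    open ≤-Reasoning
    c : Fin n → Fin n → Bool
    c u v = S u ∧ (not (S v) ∧ adj u v)

    c-parts : ∀ {u v} → c u v ≡ true → S u ≡ true × S v ≡ false × adj u v ≡ true
    c-parts {u} {v} e = let Su , rest = ∧-true⁻ (S u) e ; ¬Sv , uv = ∧-true⁻ (not (S v)) rest
                        in Su , not-true⁻ ¬Sv , uv

    upward : ∀ u → (λ v → u <ᵇ v ∧ c u v) ⊆ (λ v → u <ᵇ v ∧ inF G F u v)
    upward u v e = let u<v , cuv = ∧-true⁻ (u <ᵇ v) e ; Su , Sv , uv = c-parts cuv
                   in ∧-true⁺ u<v (leaving u v Su Sv uv)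

    downward : ∀ u → (λ v → not (v <ᵇ u) ∧ c v u) ⊆ (λ v → u <ᵇ v ∧ inF G F u v)
    downward u v e = let v≮u , cvu = ∧-true⁻ (not (v <ᵇ u)) e ; Sv , Su , vu = c-parts cvu
                         u≢v : u ≢ v
                         u≢v = λ { refl → contradiction Su (not-¬ Sv) }
                     in ∧-true⁺ (dec-true (u <ᶠ? v) (<ᵇ-false∧≢⇒< (not-true⁻ v≮u) u≢v))
                                (trans (inF-sym F u v) (leaving v u Sv Su vu))

    disjoint : ∀ u v → u <ᵇ v ∧ c u v ≡ true → not (v <ᵇ u) ∧ c v u ≡ false
    disjoint u v e = ¬-not λ e′ → let Su , _ = c-parts (proj₂ (∧-true⁻ (u <ᵇ v) e))
                                      _ , ¬Su , _ = c-parts (proj₂ (∧-true⁻ (not (v <ᵇ u)) e′))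
                                  in contradiction ¬Su (not-¬ Su)

  Closed : (Fin n → Fin n → Bool) → (Fin n → Bool) → Set
  Closed F S = ∀ a b → S a ≡ true → AdjMinus G F a b → S b ≡ true

  closed⇒leavingEdgesIn : ∀ F {S} → Closed F S →
                          ∀ a b → S a ≡ true → S b ≡ false → adj a b ≡ true → inF G F a b ≡ true
  closed⇒leavingEdgesIn F closed a b Sa Sb ab with F a b ∨ F b a in e
  ... | true  = cong (_∧ true) ab
  ... | false = contradiction Sb (not-¬ (closed a b Sa (cong₂ (λ s t → s ∧ not t) ab e)))

  adjMinusᵇ : (Fin n → Fin n → Bool) → Fin n → Fin n → Bool
  adjMinusᵇ F a b = adj a b ∧ not (F a b ∨ F b a)

  module Reachability (F : Fin n → Fin n → Bool) (u : Fin n) where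

    within : ℕ → Fin n → Bool
    within zero    x = does (x ≟ᶠ u)
    within (suc k) x = within k x ∨ does (any? λ w → within k w ∧ adjMinusᵇ F w x ≟ᵇ true)

    within-sound : ∀ k x → within k x ≡ true → Star (AdjMinus G F) u x
    within-sound zero x e with x ≟ᶠ u | e
    ... | yes refl | _  = ε
    ... | no _     | ()
    within-sound (suc k) x e with within k x in old | any? (λ w → within k w ∧ adjMinusᵇ F w x ≟ᵇ true) | e
    ... | true  | _             | _ = within-sound k x old
    ... | false | yes (w , new) | _ = let kw , wx = ∧-true⁻ (within k w) new in within-sound k w kw ◅◅ (wx ◅ ε)
    ... | false | no _          | ()

    within-start : ∀ k → within k u ≡ true
    within-start zero    = dec-true (u ≟ᶠ u) refl
    within-start (suc k) rewrite within-start k = refl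

    within-mono : ∀ k → within k ⊆ within (suc k)
    within-mono k x e rewrite e = refl

    within-step : ∀ k a b → within k a ≡ true → AdjMinus G F a b → within (suc k) b ≡ true
    within-step k a b ka ab with within k b | any? (λ w → within k w ∧ adjMinusᵇ F w b ≟ᵇ true)
    ... | true  | _      = refl
    ... | false | yes _  = refl
    ... | false | no ¬ab = contradiction (a , ∧-true⁺ ka ab) ¬ab

    closed-or-grows : ∀ k → Closed F (within k) ⊎ count (within k) < count (within (suc k))
    closed-or-grows k with any? (λ x → (within (suc k) x ≟ᵇ true) ×-dec (within k x ≟ᵇ false))
    ... | yes (x , new , old) = inj₂ (count-strict x (within-mono k) old new)
    ... | no  ¬new            = inj₁ λ a b ka ab → stays b (within-step k a b ka ab)
      where
      stays : ∀ b → within (suc k) b ≡ true → within k b ≡ true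
      stays b e with within k b ≟ᵇ true
      ... | yes kb = kb
      ... | no ¬kb = contradiction (b , e , ¬-not ¬kb) ¬new

    closed-or-large : ∀ k → (∃[ j ] Closed F (within j)) ⊎ k < count (within k)
    closed-or-large zero = inj₂ (count-pos u (within-start 0))
    closed-or-large (suc k) with closed-or-large k
    ... | inj₁ closed = inj₁ closed
    ... | inj₂ large with closed-or-grows k
    ... | inj₁ closed = inj₁ (k , closed)
    ... | inj₂ grows  = inj₂ (≤-trans (s≤s large) grows)

    closedWithin : ∃[ j ] Closed F (within j)
    closedWithin with closed-or-large n
    ... | inj₁ closed  = closed
    ... | inj₂ n<count = contradiction (count≤n (within n)) (<⇒≱ n<count)

  separatingSet : ∀ F u v → ¬ Star (AdjMinus G F) u v → ∃[ S ] (Closed F S × S u ≡ true × S v ≡ false)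
  separatingSet F u v u↛v = let j , closed = closedWithin
                            in within j , closed , within-start j , ¬-not (u↛v ∘ within-sound j v)
    where open Reachability F u

  crossingEdge : ∀ (S : Fin n → Bool) {a b} → Star (Adj G) a b → S a ≡ true → S b ≡ false →
                 ∃[ x ] ∃[ y ] (S x ≡ true × S y ≡ false × adj x y ≡ true)
  crossingEdge S ε                      Sa Sb = contradiction Sb (not-¬ Sa)
  crossingEdge S {a} (_◅_ {j = c} ac cb) Sa Sb with S c in Sc
  ... | true  = crossingEdge S cb Sc Sb
  ... | false = a , c , Sa , Sc , ac

  -- z has the least index, so edgeCount counts every edge at z in the row of z.
  module _ (z : Fin n) (z≡0 : toℕ z ≡ 0) where

    star : Fin n → Fin n → Bool
    star a b = does (a ≟ᶠ z)

    star-isolates : ∀ {w} → Star (AdjMinus G star) z w → w ≡ z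
    star-isolates ε        = refl
    star-isolates {w} (_◅_ {j = v} zv _) = contradiction zv noEdge
      where
      noEdge : ¬ AdjMinus G star z v
      noEdge e rewrite dec-true (z ≟ᶠ z) refl | ∧-zeroʳ (adj z v) with e
      ... | ()

    z<neighbour : ∀ {v} → adj z v ≡ true → toℕ z < toℕ v
    z<neighbour zv rewrite z≡0 = n≢0⇒n>0 λ v≡0 → adj⇒≢ zv (toℕ-injective (trans z≡0 (sym v≡0)))

    edgeCount-star : edgeCount G star ≡ degree G z
    edgeCount-star = begin
      edgeCount G star                         ≡⟨ edgeCount≡∑ star ⟩
      sum row                                  ≡⟨ ∑⟨⟩-remove z row refl ⟩
      row z + ∑⟨ (λ _ → true) ∖ z ⟩ row        ≡⟨ cong₂ _+_ (count-cong row-z) (∑⟨⟩-zero other-rows) ⟩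
      count (adj z) + 0                        ≡⟨ +-identityʳ _ ⟩
      count (adj z)                            ≡⟨ countB-allFin (adj z) ⟨
      degree G z ∎
      where
      open ≡-Reasoning
      row : Fin n → ℕ
      row u = count (λ v → u <ᵇ v ∧ inF G star u v)

      row-z : ∀ v → z <ᵇ v ∧ inF G star z v ≡ adj z v
      row-z v rewrite dec-true (z ≟ᶠ z) refl with adj z v in zv
      ... | false = ∧-zeroʳ (z <ᵇ v)
      ... | true  rewrite dec-true (z <ᶠ? v) (z<neighbour zv) = refl

      other-rows : ∀ u → ((λ _ → true) ∖ z) u ≡ true → row u ≡ 0
      other-rows u u≠z = count-empty empty
        where
        empty : ∀ v → u <ᵇ v ∧ inF G star u v ≡ false
        empty v rewrite dec-false (u ≟ᶠ z) (∖-≢ u≠z) with v ≟ᶠ z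
        ... | no _     rewrite ∧-zeroʳ (adj u v) = ∧-zeroʳ (u <ᵇ v)
        ... | yes refl rewrite dec-false (u <ᶠ? z) (λ u<z → n≮0 (subst (toℕ u <_) z≡0 u<z)) = refl

  isolatingCut : 2 ≤ n → ∃[ z ] ∃[ F ] (Disconnects G F × edgeCount G F ≡ degree G z)
  isolatingCut 2≤n = z , star z z≡0 , (z , z′ , z′≢z ∘ star-isolates z z≡0) , edgeCount-star z z≡0
    where
    0<n : 0 < n
    0<n = ≤-trans (s≤s z≤n) 2≤n
    z z′ : Fin n
    z  = fromℕ< 0<n
    z′ = fromℕ< 2≤n
    z≡0 : toℕ z ≡ 0
    z≡0 = toℕ-fromℕ< 0<n
    z′≢z : z′ ≢ z
    z′≢z eq with trans (sym (toℕ-fromℕ< 2≤n)) (trans (cong toℕ eq) z≡0)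
    ... | ()

  module _ {d α β : ℕ} (amply : AmplyRegular G d α β) where

    degree≡d : ∀ v → count (adj v) ≡ d
    degree≡d v = trans (sym (countB-allFin (adj v))) (proj₁ amply v)

    common-adj : ∀ {u v} → adj u v ≡ true → count (λ w → adj u w ∧ adj v w) ≡ α
    common-adj {u} {v} uv = trans (sym (countB-allFin (λ w → adj u w ∧ adj v w))) (proj₁ (proj₂ amply) u v uv)

    common-dist2 : ∀ {u v} → Dist2 G u v → count (λ w → adj u w ∧ adj v w) ≡ β
    common-dist2 {u} {v} uv = trans (sym (countB-allFin (λ w → adj u w ∧ adj v w))) (proj₂ (proj₂ amply) u v uv)

    module CrossingEdge (S : Fin n → Bool) {x y : Fin n} (Sx : S x ≡ true) (Sy : S y ≡ false) (xy : adj x y ≡ true) where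

      out : Fin n → ℕ
      out = degIn (not ∘ S)

      X C A : Fin n → Bool
      X w = S w ∧ adj y w
      C w = adj y w ∧ (S w ∧ adj x w)
      A w = not (adj y w) ∧ (S w ∧ adj x w)

      inX inA : Fin n → ℕ
      inX w = count (λ v → X v ∧ adj w v)
      inA v = count (λ w → A w ∧ adj w v)

      A-parts : ∀ {w} → A w ≡ true → adj y w ≡ false × S w ≡ true × adj x w ≡ true
      A-parts {w} e = let ¬yw , Sxw = ∧-true⁻ (not (adj y w)) e in not-true⁻ ¬yw , ∧-true⁻ (S w) Sxw

      X∖x-parts : ∀ {v} → (X ∖ x) v ≡ true → v ≢ x × S v ≡ true × adj y v ≡ true
      X∖x-parts {v} e = ∖-≢ {p = X} e , ∧-true⁻ (S v) (∖-⊆ {p = X} v e)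

      Xx : X x ≡ true
      Xx = ∧-true⁺ Sx (adj-sym′ xy)

      degree-split : d ≡ out x + count C + count A
      degree-split = begin
        d                                            ≡⟨ degree≡d x ⟨
        count (adj x)                                ≡⟨ ∑⟨⟩-split (adj x) S (λ _ → 1) ⟩
        count (λ w → S w ∧ adj x w) + out x          ≡⟨ cong (_+ out x) (∑⟨⟩-split (λ w → S w ∧ adj x w) (adj y) (λ _ → 1)) ⟩
        count C + count A + out x                    ≡⟨ +-comm (count C + count A) (out x) ⟩
        out x + (count C + count A)                  ≡⟨ +-assoc (out x) (count C) (count A) ⟨
        out x + count C + count A                    ∎
        where open ≡-Reasoning

      C⊆X∖x : C ⊆ (X ∖ x)
      C⊆X∖x w e = let yw , Sxw = ∧-true⁻ (adj y w) e ; Sw , xw = ∧-true⁻ (S w) Sxw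
                  in ∖-intro {p = X} (∧-true⁺ Sw yw) (adj⇒≢ xw ∘ sym)

      cutSize-lower : out x + ∑⟨ X ∖ x ⟩ out + ∑⟨ A ⟩ out ≤ cutSize S
      cutSize-lower = begin
        out x + ∑⟨ X ∖ x ⟩ out + ∑⟨ A ⟩ out    ≡⟨ cong (_+ ∑⟨ A ⟩ out) (∑⟨⟩-remove x out Xx) ⟨
        ∑⟨ X ⟩ out + ∑⟨ A ⟩ out                ≤⟨ ∑⟨⟩-disjoint out X⊆S A⊆S X∩A≡∅ ⟩
        cutSize S                              ∎
        where
        open ≤-Reasoning
        X⊆S : X ⊆ S
        X⊆S w e = proj₁ (∧-true⁻ (S w) e)
        A⊆S : A ⊆ S
        A⊆S w e = proj₁ (proj₂ (A-parts e))
        X∩A≡∅ : ∀ w → X w ≡ true → A w ≡ false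
        X∩A≡∅ w e rewrite proj₂ (∧-true⁻ (S w) e) = refl

      X∖x-leaves : ∀ v → (X ∖ x) v ≡ true → 0 < out v
      X∖x-leaves v e = count-pos y (∧-true⁺ (cong not Sy) (adj-sym′ (proj₂ (proj₂ (X∖x-parts e)))))

      A-dist2 : ∀ w → A w ≡ true → Dist2 G w y
      A-dist2 w e = let yw , Sw , xw = A-parts e
                        w≢y : w ≢ y
                        w≢y = λ { refl → contradiction Sy (not-¬ Sw) }
                    in w≢y , trans (adj-sym w y) yw , x , adj-sym′ xw , xy

      β≤inX+out : ∀ w → A w ≡ true → β ≤ inX w + out w
      β≤inX+out w e = begin
        β                                                       ≡⟨ common-dist2 (A-dist2 w e) ⟨
        count (λ v → adj w v ∧ adj y v)                         ≡⟨ ∑⟨⟩-split (λ v → adj w v ∧ adj y v) S (λ _ → 1) ⟩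
        count (λ v → S v ∧ (adj w v ∧ adj y v)) + count (λ v → not (S v) ∧ (adj w v ∧ adj y v))
                                                                ≤⟨ +-mono-≤ (count-mono inside) (count-mono outside) ⟩
        inX w + out w                                           ∎
        where
        open ≤-Reasoning
        inside : (λ v → S v ∧ (adj w v ∧ adj y v)) ⊆ (λ v → X v ∧ adj w v)
        inside v e = let Sv , wyv = ∧-true⁻ (S v) e ; wv , yv = ∧-true⁻ (adj w v) wyv
                     in ∧-true⁺ (∧-true⁺ Sv yv) wv
        outside : (λ v → not (S v) ∧ (adj w v ∧ adj y v)) ⊆ (λ v → not (S v) ∧ adj w v)
        outside v e = let ¬Sv , wyv = ∧-true⁻ (not (S v)) e in ∧-true⁺ ¬Sv (proj₁ (∧-true⁻ (adj w v) wyv))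

      d≤cutSize-if-A-leaves : (∀ w → A w ≡ true → 0 < out w) → d ≤ cutSize S
      d≤cutSize-if-A-leaves A-leaves = begin
        d                                     ≡⟨ degree-split ⟩
        out x + count C + count A             ≤⟨ +-mono-≤ (+-monoʳ-≤ (out x) C≤) (count≤∑⟨⟩ A-leaves) ⟩
        out x + ∑⟨ X ∖ x ⟩ out + ∑⟨ A ⟩ out   ≤⟨ cutSize-lower ⟩
        cutSize S                             ∎
        where
        open ≤-Reasoning
        C≤ : count C ≤ ∑⟨ X ∖ x ⟩ out
        C≤ = ≤-trans (count-mono C⊆X∖x) (count≤∑⟨⟩ X∖x-leaves)

      d≤cutSize-if-sparse : degIn S y < β → d ≤ cutSize S
      d≤cutSize-if-sparse sparse = d≤cutSize-if-A-leaves A-leaves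
        where
        A-leaves : ∀ w → A w ≡ true → 0 < out w
        A-leaves w e = +-cancelˡ-< (inX w) 0 (out w) (begin-strict
          inX w + 0      ≡⟨ +-identityʳ (inX w) ⟩
          inX w          ≤⟨ count-mono (λ v e′ → proj₁ (∧-true⁻ (X v) e′)) ⟩
          degIn S y      <⟨ sparse ⟩
          β              ≤⟨ β≤inX+out w e ⟩
          inX w + out w  ∎)
          where open ≤-Reasoning

      d≤cutSize-if-β≡0 : β ≡ 0 → d ≤ cutSize S
      d≤cutSize-if-β≡0 β≡0 = d≤cutSize-if-A-leaves λ w e →
        let _ , _ , xw = A-parts e
            x-common = count-pos {p = λ v → adj w v ∧ adj y v} x (∧-true⁺ (adj-sym′ xw) (adj-sym′ xy))
        in contradiction (subst (0 <_) (trans (common-dist2 (A-dist2 w e)) β≡0) x-common) λ ()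

      inA<β : α ≤ β → ∀ v → (X ∖ x) v ≡ true → inA v < β
      inA<β α≤β v e = <-≤-trans (count-strict y A∧adj⊆common Ay∧adj≡false common-y) common≤β
        where
        v≢x : v ≢ x
        v≢x = proj₁ (X∖x-parts e)
        yv : adj y v ≡ true
        yv = proj₂ (proj₂ (X∖x-parts e))
        A∧adj⊆common : (λ w → A w ∧ adj w v) ⊆ (λ w → adj v w ∧ adj x w)
        A∧adj⊆common w e′ = let Aw , wv = ∧-true⁻ (A w) e′ in ∧-true⁺ (adj-sym′ wv) (proj₂ (proj₂ (A-parts Aw)))
        Ay∧adj≡false : A y ∧ adj y v ≡ false
        Ay∧adj≡false rewrite Sy | irrefl y = refl
        common-y : adj v y ∧ adj x y ≡ true
        common-y = ∧-true⁺ (adj-sym′ yv) xy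
        common≤β : count (λ w → adj v w ∧ adj x w) ≤ β
        common≤β with adj v x in vx
        ... | true  = ≤-trans (≤-reflexive (common-adj vx)) α≤β
        ... | false = ≤-reflexive (common-dist2 (v≢x , vx , y , adj-sym′ yv , adj-sym′ xy))

      edgesAX-bound : α ≤ β → ∑⟨ A ⟩ inX + count (X ∖ x) ≤ count A + count (X ∖ x) * β
      edgesAX-bound α≤β = begin
        ∑⟨ A ⟩ inX + k                             ≡⟨ cong (_+ k) (∑⟨⟩-count-comm A X adj) ⟩
        ∑⟨ X ⟩ inA + k                             ≡⟨ cong (_+ k) (∑⟨⟩-remove x inA Xx) ⟩
        inA x + ∑⟨ X ∖ x ⟩ inA + k                 ≡⟨ +-assoc (inA x) (∑⟨ X ∖ x ⟩ inA) k ⟩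
        inA x + (∑⟨ X ∖ x ⟩ inA + k)               ≡⟨ cong (inA x +_) (+-comm (∑⟨ X ∖ x ⟩ inA) k) ⟩
        inA x + (k + ∑⟨ X ∖ x ⟩ inA)               ≡⟨ cong (inA x +_) (∑⟨⟩-distrib-+ (X ∖ x) (λ _ → 1) inA) ⟨
        inA x + ∑⟨ X ∖ x ⟩ (λ v → suc (inA v))
          ≤⟨ +-mono-≤ (count-mono λ w e → proj₁ (∧-true⁻ (A w) e)) (∑⟨⟩-≤-const (inA<β α≤β)) ⟩
        count A + k * β                            ∎
        where
        open ≤-Reasoning
        k = count (X ∖ x)

      d≤cutSize-if-dense : α ≤ β → 2 ≤ β → (∀ v → (X ∖ x) v ≡ true → β ≤ out v) → d ≤ cutSize S
      d≤cutSize-if-dense α≤β 2≤β dense = begin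
        d                                  ≡⟨ degree-split ⟩
        out x + count C + count A          ≤⟨ +-monoˡ-≤ (count A) (+-monoʳ-≤ (out x) (count-mono C⊆X∖x)) ⟩
        out x + count (X ∖ x) + count A
          ≤⟨ dense-arith {k = count (X ∖ x)} {s = count A}
                         cutSize-lower (∑⟨⟩-≥-const dense) A-bound (edgesAX-bound α≤β) 2≤β ⟩
        cutSize S                          ∎
        where
        open ≤-Reasoning
        A-bound : count A * β ≤ ∑⟨ A ⟩ inX + ∑⟨ A ⟩ out
        A-bound = subst (count A * β ≤_) (∑⟨⟩-distrib-+ A inX out) (∑⟨⟩-≥-const β≤inX+out)

    d≤cutSize : α ≤ β → β ≢ 1 → ∀ S {x y} → S x ≡ true → S y ≡ false → adj x y ≡ true → d ≤ cutSize S
    d≤cutSize α≤β β≢1 S {x} {y} Sx Sy xy = byCases (any? λ v → ((X ∖ x) v ≟ᵇ true) ×-dec (out v <? β))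
      where
      open CrossingEdge S Sx Sy xy
      byCases : Dec (∃[ v ] ((X ∖ x) v ≡ true × out v < β)) → d ≤ cutSize S
      byCases (yes (v , e , sparse)) =
        -- v has fewer than β neighbours in the complement of S, which contains y
        let _ , Sv , yv = X∖x-parts e
        in subst (d ≤_) (cutSize-complement S)
             (CrossingEdge.d≤cutSize-if-sparse (not ∘ S) (cong not Sy) (cong not Sv) yv sparse)
      byCases (no ¬sparse) with ≢1⇒≡0⊎≥2 β≢1
      ... | inj₁ β≡0 = d≤cutSize-if-β≡0 β≡0
      ... | inj₂ 2≤β = d≤cutSize-if-dense α≤β 2≤β λ v e → ≮⇒≥ λ sparse → ¬sparse (v , e , sparse)

    d≤edgeCount : Connected G → α ≤ β → β ≢ 1 → ∀ F → Disconnects G F → d ≤ edgeCount G F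
    d≤edgeCount connected α≤β β≢1 F (u , v , u↛v) =
      let S , closed , Su , Sv = separatingSet F u v u↛v
          x , y , Sx , Sy , xy = crossingEdge S (connected u v) Su Sv
      in ≤-trans (d≤cutSize α≤β β≢1 S Sx Sy xy) (cutSize≤edgeCount F S (closed⇒leavingEdgesIn F closed))

corollary1p6 : (G : Graph) → (d α β : ℕ) → 2 ≤ Graph.n G → Connected G
    → AmplyRegular G d α β → 1 ≢ β → β ≥ α → EdgeConnectivity G d
corollary1p6 G d α β 2≤n connected amply 1≢β β≥α =
  d≤edgeCount G amply connected β≥α (1≢β ∘ sym) ,
  (let z , F , disconnects , size = isolatingCut G 2≤n in F , disconnects , trans size (proj₁ amply z))
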